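{- Let $n\ge1$ and let $a_1\cdots a_n$ be a word with $1\le a_i\le 2i-1$ for all $i$. The standard permutation $\pi(a_1\cdots a_n)$ is sign-disconnected if and only if there exists $k\in\{2,\ldots,n\}$ such that $a_k=2k-1$ and $a_j\ge 2k-1$ for all $j$ with $k<j\le n$.
   Context: A standard permutation of $\{\pm1,\ldots,\pm n\}$ is a word in which each element of $\{\pm1,\ldots,\pm n\}$ appears exactly once, such that for every $i$, $i$ occurs before $-i$, and the negative entries occur in the order $-1,\ldots,-n$. For a word $a_1\cdots a_n$ with $1\le a_i\le 2i-1$, the standard permutation $\pi(a_1\cdots a_n)$ of $\{\pm1,\ldots,\pm n\}$ is defined recursively: $\pi(a_1)=(1,-1)$, and for $n\ge2$, $\pi(a_1\cdots a_n)$ is obtained from the word $\pi(a_1\cdots a_{n-1})$ (of length $2n-2$) by inserting the letter $n$ so that it occupies position $a_n$, and then appending $-n$ at the end. A permutation $\pi$ of $\{\pm1,\ldots,\pm n\}$ is sign-connected if for every $1\le m<2n$ there is $j\in\{1,\ldots,n\}$ with $|\{\pi(1),\ldots,\pi(m)\}\cap\{ -j,j\}|=1$; otherwise sign-disconnected. -}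

module Defs where

open import Data.Nat using (ℕ; zero; suc; _+_; _*_; _∸_; _≤_; _<_)
open import Data.Integer using (ℤ; +_; -_)
import Data.Integer as ℤ
open import Data.List using (List; []; _∷_; _++_; take; drop; [_])
open import Data.List.Membership.Propositional using (_∈_)
open import Data.Product using (_×_; Σ)
open import Data.Sum using (_⊎_)
open import Relation.Nullary using (¬_)

insertAtPos : ℕ → ℤ → List ℤ → List ℤ
insertAtPos p x w = take (p ∸ 1) w ++ (x ∷ drop (p ∸ 1) w)

-- go as k acc : acc is π(a_1 ... a_{k-1}); processes letter a_k, a_{k+1}, ...
stdPermGo : List ℕ → ℕ → List ℤ → List ℤ
stdPermGo []       k acc = acc
stdPermGo (a ∷ as) k acc =
  stdPermGo as (suc k) (insertAtPos a (+ k) acc ++ [ - (+ k) ])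

-- The standard permutation π(a_1 ⋯ a_n), as a word over ℤ (letters ±1,…,±n).
-- π(a_1) = (1,-1) arises from inserting 1 into the empty word (a_1 = 1).
stdPerm : List ℕ → List ℤ
stdPerm w = stdPermGo w 1 []

ExactlyOneSign : List ℤ → ℕ → Set
ExactlyOneSign p j =
  ((+ j) ∈ p × ¬ ((- (+ j)) ∈ p)) ⊎ (¬ ((+ j) ∈ p) × (- (+ j)) ∈ p)

SignConnected : ℕ → List ℤ → Set
SignConnected n π =
  (m : ℕ) → 1 ≤ m → m < 2 * n →
  Σ ℕ (λ j → 1 ≤ j × j ≤ n × ExactlyOneSign (take m π) j)

SignDisconnected : ℕ → List ℤ → Set
SignDisconnected n π = ¬ SignConnected n π

module Submission where

-- Write d_j = a_{j+1} - 1 for the number of letters that precede the letter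
-- j+1 at the moment it is inserted, and π_k for the word after k insertion
-- steps (so π_k has length 2k and consists of the letters ±1,…,±k).
--
-- A prefix of a word is *balanced* if no letter occurs in it with exactly one
-- sign; π is sign-disconnected iff some prefix of length 1 ≤ m < 2n is
-- balanced (everything is finite, hence decidable).  The heart of the proof
-- is a characterisation of the balanced prefixes of π_k: the prefix of
-- length m is balanced iff m = 2r and every later letter j+1 (r ≤ j < k) is
-- inserted after the first 2r positions (d_j ≥ 2r).  Indeed, such a prefix
-- is exactly π_r, which contains every letter with both signs; conversely,
-- if a later insertion lands inside the prefix, the new letter k+1 appears
-- in it without its partner -(k+1), which is only appended at the very end.
-- For r = toℕ k the condition "d_j ≥ 2r for all j ≥ r" is, under the bounds
-- 1 ≤ a_i ≤ 2i-1, precisely  a_k = 2k-1  and  a_j ≥ 2k-1  for j > k.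

open import Defs
open import Data.Nat using (ℕ; zero; suc; _+_; _*_; _∸_; _≤_; _<_; _≥_; z≤n; s≤s; s≤s⁻¹; _≤?_; _<?_)
open import Data.Nat.Properties
open import Data.Integer using (ℤ; +_; -[1+_]; -_)
import Data.Integer as ℤ
open import Data.Fin using (Fin; toℕ; fromℕ<)
import Data.Fin as Fin
open import Data.Fin.Properties using (toℕ<n; toℕ-fromℕ<; toℕ-injective)
open import Data.Vec using (Vec; lookup; toList)
import Data.Vec as Vec
open import Data.Vec.Properties using (length-toList)
open import Data.List using (List; []; _∷_; _++_; take; drop; [_]; length)
open import Data.List.Properties using (length-++; take-all)
open import Data.List.Membership.Propositional using (_∈_; _∉_)
open import Data.List.Membership.Propositional.Properties using (∈-++⁺ˡ; ∈-++⁺ʳ; ∈-++⁻)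
open import Data.List.Membership.DecPropositional ℤ._≟_ using (_∈?_)
open import Data.List.Relation.Unary.Any using (here; there)
open import Data.Product using (_×_; Σ; _,_; proj₁; proj₂)
open import Data.Sum using (_⊎_; inj₁; inj₂)
import Data.Sum as Sum
open import Data.Empty using (⊥-elim)
open import Relation.Nullary using (¬_; Dec; yes; no; ¬?)
open import Relation.Nullary.Decidable using (_×-dec_; _⊎-dec_; map′; decidable-stable)
open import Function using (_∘_)
open import Function.Bundles using (_⇔_; mk⇔; Equivalence)
open import Function.Properties.Equivalence using () renaming (trans to ⇔-trans)
open import Relation.Binary.PropositionalEquality using (_≡_; refl; sym; trans; cong; subst; module ≡-Reasoning)

ins : {A : Set} → ℕ → A → List A → List A
ins zero    x w       = x ∷ w
ins (suc i) x []      = x ∷ []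
ins (suc i) x (y ∷ w) = y ∷ ins i x w

insertAtPos≡ins : ∀ p (x : ℤ) w → insertAtPos p x w ≡ ins (p ∸ 1) x w
insertAtPos≡ins p x w = go (p ∸ 1) w
  where
  go : ∀ i w → take i w ++ (x ∷ drop i w) ≡ ins i x w
  go zero    w       = refl
  go (suc i) []      = refl
  go (suc i) (y ∷ w) = cong (y ∷_) (go i w)

length-ins : {A : Set} (i : ℕ) (x : A) (w : List A) → length (ins i x w) ≡ suc (length w)
length-ins zero    x w       = refl
length-ins (suc i) x []      = refl
length-ins (suc i) x (y ∷ w) = cong suc (length-ins i x w)

∈-ins-new : {A : Set} (i : ℕ) (x : A) (w : List A) → x ∈ ins i x w
∈-ins-new zero    x w       = here refl
∈-ins-new (suc i) x []      = here refl
∈-ins-new (suc i) x (y ∷ w) = there (∈-ins-new i x w)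

∈-ins-old : {A : Set} (i : ℕ) (x : A) {z : A} (w : List A) → z ∈ w → z ∈ ins i x w
∈-ins-old zero    x w       p         = there p
∈-ins-old (suc i) x (y ∷ w) (here p)  = here p
∈-ins-old (suc i) x (y ∷ w) (there p) = there (∈-ins-old i x w p)

∈-ins⁻ : {A : Set} (i : ℕ) (x : A) {z : A} (w : List A) → z ∈ ins i x w → z ≡ x ⊎ z ∈ w
∈-ins⁻ zero    x w       (here p)  = inj₁ p
∈-ins⁻ zero    x w       (there p) = inj₂ p
∈-ins⁻ (suc i) x []      (here p)  = inj₁ p
∈-ins⁻ (suc i) x (y ∷ w) (here p)  = inj₂ (here p)
∈-ins⁻ (suc i) x (y ∷ w) (there p) = Sum.map₂ there (∈-ins⁻ i x w p)

take-ins-before : {A : Set} (m i : ℕ) (x : A) (w : List A) → m ≤ i → m ≤ length w →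
                  take m (ins i x w) ≡ take m w
take-ins-before zero    i       x w       _         _         = refl
take-ins-before (suc m) (suc i) x (y ∷ w) (s≤s m≤i) (s≤s m≤w) =
  cong (y ∷_) (take-ins-before m i x w m≤i m≤w)

take-ins : {A : Set} (m i : ℕ) (x : A) (w : List A) →
           (m ≤ i × m ≤ length w × take m (ins i x w) ≡ take m w) ⊎ x ∈ take m (ins i x w)
take-ins zero    i       x w       = inj₁ (z≤n , z≤n , refl)
take-ins (suc m) zero    x w       = inj₂ (here refl)
take-ins (suc m) (suc i) x []      = inj₂ (here refl)
take-ins (suc m) (suc i) x (y ∷ w) with take-ins m i x w
... | inj₁ (m≤i , m≤w , eq) = inj₁ (s≤s m≤i , s≤s m≤w , cong (y ∷_) eq)
... | inj₂ x∈               = inj₂ (there x∈)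

take-++ˡ : {A : Set} (m : ℕ) (xs ys : List A) → m ≤ length xs → take m (xs ++ ys) ≡ take m xs
take-++ˡ zero    xs       ys _         = refl
take-++ˡ (suc m) (x ∷ xs) ys (s≤s m≤n) = cong (x ∷_) (take-++ˡ m xs ys m≤n)

∈-take⁻ : {A : Set} (m : ℕ) {z : A} (xs : List A) → z ∈ take m xs → z ∈ xs
∈-take⁻ (suc m) (x ∷ xs) (here p)  = here p
∈-take⁻ (suc m) (x ∷ xs) (there p) = there (∈-take⁻ m xs p)

Unbalanced : ℕ → List ℤ → Set
Unbalanced n l = Σ ℕ (λ j → 1 ≤ j × j ≤ n × ExactlyOneSign l j)

Balanced : ℕ → List ℤ → Set
Balanced n l = ¬ Unbalanced n l

unbalanced? : ∀ n l → Dec (Unbalanced n l)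
unbalanced? n l =
  map′ (λ (j , j<1+n , 1≤j , e) → j , 1≤j , s≤s⁻¹ j<1+n , e)
       (λ (j , 1≤j , j≤n , e) → j , s≤s j≤n , 1≤j , e)
       (anyUpTo? (λ j → (1 ≤? j) ×-dec exactlyOneSign? j) (suc n))
  where
  exactlyOneSign? : ∀ j → Dec (ExactlyOneSign l j)
  exactlyOneSign? j = ((+ j ∈? l) ×-dec ¬? (- (+ j) ∈? l)) ⊎-dec (¬? (+ j ∈? l) ×-dec (- (+ j) ∈? l))

HasBalancedPrefix : ℕ → List ℤ → Set
HasBalancedPrefix n π = Σ ℕ (λ m → m < 2 * n × 1 ≤ m × Balanced n (take m π))

-- Sign-disconnectedness is the existence of a balanced proper prefix; the
-- forward direction is a finite search, which is constructive by decidability.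
disconnected⇔balancedPrefix : ∀ n π → SignDisconnected n π ⇔ HasBalancedPrefix n π
disconnected⇔balancedPrefix n π = mk⇔ to from
  where
  to : SignDisconnected n π → HasBalancedPrefix n π
  to disconnected =
    decidable-stable (anyUpTo? (λ m → (1 ≤? m) ×-dec ¬? (unbalanced? n (take m π))) (2 * n))
      λ none → disconnected λ m 1≤m m<2n →
        decidable-stable (unbalanced? n (take m π)) λ bal → none (m , m<2n , 1≤m , bal)

  from : HasBalancedPrefix n π → SignDisconnected n π
  from (m , m<2n , 1≤m , bal) connected = bal (connected m 1≤m m<2n)

-- The (i+1)-th letter of a list of numbers, 0 past its end.
nth : List ℕ → ℕ → ℕ
nth []       _       = 0
nth (x ∷ xs) zero    = x
nth (x ∷ xs) (suc i) = nth xs i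

-- d j is the number of letters preceding the letter j+1 when it is inserted.
module Insertion (d : ℕ → ℕ) where

  inserted : ℕ → List ℤ
  perm     : ℕ → List ℤ
  inserted k    = ins (d k) (+ suc k) (perm k)
  perm zero     = []
  perm (suc k)  = inserted k ++ [ -[1+ k ] ]

  length-perm : ∀ k → length (perm k) ≡ 2 * k
  length-perm zero    = refl
  length-perm (suc k) = begin
    length (inserted k ++ [ -[1+ k ] ])  ≡⟨ length-++ (inserted k) ⟩
    length (inserted k) + 1              ≡⟨ cong (_+ 1) (length-ins (d k) (+ suc k) (perm k)) ⟩
    suc (length (perm k)) + 1            ≡⟨ cong (λ l → suc l + 1) (length-perm k) ⟩
    suc (2 * k) + 1                      ≡⟨ +-comm (suc (2 * k)) 1 ⟩
    suc (suc (2 * k))                    ≡⟨ sym (*-suc 2 k) ⟩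
    2 * suc k                            ∎
    where open ≡-Reasoning

  length-inserted : ∀ k → length (inserted k) ≡ suc (2 * k)
  length-inserted k = trans (length-ins (d k) (+ suc k) (perm k)) (cong suc (length-perm k))

  ∈-perm⁻ : ∀ k {z} → z ∈ perm k → Σ ℕ (λ j → j < k × (z ≡ + suc j ⊎ z ≡ -[1+ j ]))
  ∈-perm⁻ (suc k) p with ∈-++⁻ (inserted k) p
  ... | inj₂ (here q) = k , ≤-refl , inj₂ q
  ... | inj₁ q with ∈-ins⁻ (d k) (+ suc k) (perm k) q
  ...   | inj₁ r = k , ≤-refl , inj₁ r
  ...   | inj₂ r with ∈-perm⁻ k r
  ...     | j , j<k , e = j , m<n⇒m<1+n j<k , e

  fresh : ∀ k j → k ≤ j → + suc j ∉ perm k × -[1+ j ] ∉ perm k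
  fresh k j k≤j = absent-pos , absent-neg
    where
    absent-pos : + suc j ∉ perm k
    absent-pos p with ∈-perm⁻ k p
    ... | j' , j'<k , inj₁ refl = <⇒≱ j'<k k≤j
    absent-neg : -[1+ j ] ∉ perm k
    absent-neg p with ∈-perm⁻ k p
    ... | j' , j'<k , inj₂ refl = <⇒≱ j'<k k≤j

  ∈-perm⁺ : ∀ k j → j < k → + suc j ∈ perm k × -[1+ j ] ∈ perm k
  ∈-perm⁺ (suc k) j (s≤s j≤k) with m≤n⇒m<n∨m≡n j≤k
  ... | inj₂ refl = ∈-++⁺ˡ (∈-ins-new (d j) (+ suc j) (perm j)) , ∈-++⁺ʳ (inserted j) (here refl)
  ... | inj₁ j<k  = old (proj₁ (∈-perm⁺ k j j<k)) , old (proj₂ (∈-perm⁺ k j j<k))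
    where
    old : ∀ {z} → z ∈ perm k → z ∈ perm (suc k)
    old = ∈-++⁺ˡ ∘ ∈-ins-old (d k) (+ suc k) (perm k)

  -- Hence every letter occurs in perm r with both signs or with neither.
  perm-balanced : ∀ r n → Balanced n (perm r)
  perm-balanced r n (suc j , _ , _ , oneSign) with j <? r | oneSign
  ... | yes j<r | inj₁ (_ , ¬neg) = ¬neg (proj₂ (∈-perm⁺ r j j<r))
  ... | yes j<r | inj₂ (¬pos , _) = ¬pos (proj₁ (∈-perm⁺ r j j<r))
  ... | no j≮r  | inj₁ (pos , _)  = proj₁ (fresh r j (≮⇒≥ j≮r)) pos
  ... | no j≮r  | inj₂ (_ , neg)  = proj₂ (fresh r j (≮⇒≥ j≮r)) neg

  KeepsPrefix : ℕ → ℕ → Set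
  KeepsPrefix r k = ∀ j → r ≤ j → j < k → 2 * r ≤ d j

  take-perm : ∀ r k → r ≤ k → KeepsPrefix r k → take (2 * r) (perm k) ≡ perm r
  take-perm r zero    z≤n _    = refl
  take-perm r (suc k) r≤1+k keeps with m≤n⇒m<n∨m≡n r≤1+k
  ... | inj₂ refl = take-all (2 * r) (perm r) (≤-reflexive (length-perm r))
  ... | inj₁ (s≤s r≤k) = begin
    take (2 * r) (inserted k ++ [ -[1+ k ] ])  ≡⟨ take-++ˡ (2 * r) (inserted k) _ 2r≤inserted ⟩
    take (2 * r) (inserted k)                  ≡⟨ take-ins-before (2 * r) (d k) (+ suc k) (perm k)
                                                    (keeps k r≤k ≤-refl) 2r≤perm ⟩
    take (2 * r) (perm k)                      ≡⟨ take-perm r k r≤k (λ j r≤j j<k → keeps j r≤j (m<n⇒m<1+n j<k)) ⟩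
    perm r                                     ∎
    where
    open ≡-Reasoning
    2r≤perm : 2 * r ≤ length (perm k)
    2r≤perm = subst (2 * r ≤_) (sym (length-perm k)) (*-monoʳ-≤ 2 r≤k)
    2r≤inserted : 2 * r ≤ length (inserted k)
    2r≤inserted = subst (2 * r ≤_) (sym (length-ins (d k) (+ suc k) (perm k))) (m≤n⇒m≤1+n 2r≤perm)

  newLetter-unbalanced : ∀ k m → m ≤ suc (2 * k) → + suc k ∈ take m (inserted k) →
                         Unbalanced (suc k) (take m (perm (suc k)))
  newLetter-unbalanced k m m≤ new∈ =
    suc k , s≤s z≤n , ≤-refl , inj₁ (subst (+ suc k ∈_) (sym prefix) new∈ , neg∉)
    where
    prefix : take m (perm (suc k)) ≡ take m (inserted k)
    prefix = take-++ˡ m (inserted k) _ (subst (m ≤_) (sym (length-inserted k)) m≤)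
    neg∉ : -[1+ k ] ∉ take m (perm (suc k))
    neg∉ p with ∈-ins⁻ (d k) (+ suc k) (perm k) (∈-take⁻ m (inserted k) (subst (-[1+ k ] ∈_) prefix p))
    ... | inj₂ q = proj₂ (fresh k k ≤-refl) q

  balanced-prefix : ∀ k m → m ≤ 2 * k → Balanced k (take m (perm k)) →
                    Σ ℕ (λ r → m ≡ 2 * r × KeepsPrefix r k)
  balanced-prefix zero    zero _ _   = 0 , refl , λ _ _ ()
  balanced-prefix (suc k) m m≤ bal with m ≤? suc (2 * k)
  ... | no m≰ = suc k , ≤-antisym m≤ (subst (_≤ m) (sym (*-suc 2 k)) (≰⇒> m≰)) , λ j k<j j≤k → ⊥-elim (<⇒≱ j≤k k<j)
  ... | yes m≤1+2k with take-ins m (d k) (+ suc k) (perm k)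
  ...   | inj₂ new∈ = ⊥-elim (bal (newLetter-unbalanced k m m≤1+2k new∈))
  ...   | inj₁ (m≤dk , m≤perm , eq) with balanced-prefix k m (subst (m ≤_) (length-perm k) m≤perm) bal'
    where
    bal' : Balanced k (take m (perm k))
    bal' (j , 1≤j , j≤k , e) =
      bal (j , 1≤j , m≤n⇒m≤1+n j≤k ,
           subst (λ l → ExactlyOneSign l j)
                 (sym (trans (take-++ˡ m (inserted k) _ (subst (m ≤_) (sym (length-inserted k)) m≤1+2k)) eq)) e)
  ...     | r , refl , keeps = r , refl , keeps'
    where
    keeps' : KeepsPrefix r (suc k)
    keeps' j r≤j (s≤s j≤k) with m≤n⇒m<n∨m≡n j≤k
    ... | inj₁ j<k  = keeps j r≤j j<k
    ... | inj₂ refl = m≤dk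

  SplitPoint : ℕ → Set
  SplitPoint n = Σ (Fin n) (λ k → 1 ≤ toℕ k × KeepsPrefix (toℕ k) n)

  disconnected⇔split : ∀ n → SignDisconnected n (perm n) ⇔ SplitPoint n
  disconnected⇔split n = ⇔-trans (disconnected⇔balancedPrefix n (perm n)) (mk⇔ to from)
    where
    to : HasBalancedPrefix n (perm n) → SplitPoint n
    to (m , m<2n , 1≤m , bal) with balanced-prefix n m (<⇒≤ m<2n) bal
    ... | r , refl , keeps =
      fromℕ< r<n , subst (1 ≤_) (sym r≡) (*-cancelˡ-< 2 0 r 1≤m) , subst (λ r → KeepsPrefix r n) (sym r≡) keeps
      where
      r<n : r < n
      r<n = *-cancelˡ-< 2 r n m<2n
      r≡ : toℕ (fromℕ< r<n) ≡ r
      r≡ = toℕ-fromℕ< r<n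

    from : SplitPoint n → HasBalancedPrefix n (perm n)
    from (k , 1≤k , keeps) =
      2 * toℕ k , *-monoʳ-< 2 (toℕ<n k) , *-monoʳ-< 2 1≤k ,
      subst (Balanced n) (sym (take-perm (toℕ k) n (<⇒≤ (toℕ<n k)) keeps)) (perm-balanced (toℕ k) n)

  stdPermGo≡perm : ∀ xs k → (∀ i → nth xs i ∸ 1 ≡ d (k + i)) →
                   stdPermGo xs (suc k) (perm k) ≡ perm (k + length xs)
  stdPermGo≡perm [] k _ = cong perm (sym (+-identityʳ k))
  stdPermGo≡perm (x ∷ xs) k matches = begin
    stdPermGo xs (suc (suc k)) (insertAtPos x (+ suc k) (perm k) ++ [ -[1+ k ] ])
      ≡⟨ cong (λ w → stdPermGo xs (suc (suc k)) (w ++ [ -[1+ k ] ])) (insertAtPos≡ins x (+ suc k) (perm k)) ⟩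
    stdPermGo xs (suc (suc k)) (ins (x ∸ 1) (+ suc k) (perm k) ++ [ -[1+ k ] ])
      ≡⟨ cong (λ i → stdPermGo xs (suc (suc k)) (ins i (+ suc k) (perm k) ++ [ -[1+ k ] ]))
              (trans (matches 0) (cong d (+-identityʳ k))) ⟩
    stdPermGo xs (suc (suc k)) (perm (suc k))
      ≡⟨ stdPermGo≡perm xs (suc k) (λ i → trans (matches (suc i)) (cong d (+-suc k i))) ⟩
    perm (suc k + length xs)
      ≡⟨ cong perm (sym (+-suc k (length xs))) ⟩
    perm (k + suc (length xs))
      ∎
    where open ≡-Reasoning

offsets : {n : ℕ} → Vec ℕ n → ℕ → ℕ
offsets a j = nth (toList a) j ∸ 1

offsets-lookup : {n : ℕ} (a : Vec ℕ n) (i : Fin n) → offsets a (toℕ i) ≡ lookup a i ∸ 1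
offsets-lookup (x Vec.∷ a) Fin.zero    = refl
offsets-lookup (x Vec.∷ a) (Fin.suc i) = offsets-lookup a i

stdPerm≡perm : {n : ℕ} (a : Vec ℕ n) → stdPerm (toList a) ≡ Insertion.perm (offsets a) n
stdPerm≡perm a = trans (Insertion.stdPermGo≡perm (offsets a) (toList a) 0 (λ i → refl))
                       (cong (Insertion.perm (offsets a)) (length-toList a))

-- The paper's condition at position k+1 of the word a.
Criterion : {n : ℕ} → Vec ℕ n → Fin n → Set
Criterion {n} a k = lookup a k ≡ 2 * toℕ k + 1 × ((j : Fin n) → toℕ k < toℕ j → lookup a j ≥ 2 * toℕ k + 1)

-- Both say a_i ≥ 2k+1 for all i ≥ k: the offset bound
-- d_i ≥ 2k reads a_i ≥ 2k+1 as a_i ≥ 1, and at i = k the upper bound a_k ≤ 2k+1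
-- turns this into equality.
keeps⇔criterion : {n : ℕ} (a : Vec ℕ n) →
  ((i : Fin n) → 1 ≤ lookup a i × lookup a i ≤ 2 * toℕ i + 1) →
  (k : Fin n) → Insertion.KeepsPrefix (offsets a) (toℕ k) n ⇔ Criterion a k
keeps⇔criterion {n} a bounds k = mk⇔ (lower⇒criterion ∘ keeps⇒lower) (lower⇒keeps ∘ criterion⇒lower)
  where
  r = toℕ k

  LowerBound : Set
  LowerBound = ∀ (i : Fin n) → r ≤ toℕ i → lookup a i ≥ 2 * r + 1

  keeps⇒lower : Insertion.KeepsPrefix (offsets a) r n → LowerBound
  keeps⇒lower keeps i r≤i =
    m≤o∸n⇒m+n≤o (2 * r) (proj₁ (bounds i)) (subst (2 * r ≤_) (offsets-lookup a i) (keeps (toℕ i) r≤i (toℕ<n i)))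

  lower⇒keeps : LowerBound → Insertion.KeepsPrefix (offsets a) r n
  lower⇒keeps lower j r≤j j<n = begin
    2 * r                              ≤⟨ m+n≤o⇒m≤o∸n (2 * r) (lower i (subst (r ≤_) (sym j≡) r≤j)) ⟩
    lookup a i ∸ 1                     ≡⟨ sym (offsets-lookup a i) ⟩
    offsets a (toℕ i)                  ≡⟨ cong (offsets a) j≡ ⟩
    offsets a j                        ∎
    where
    open ≤-Reasoning
    i = fromℕ< j<n
    j≡ : toℕ i ≡ j
    j≡ = toℕ-fromℕ< j<n

  lower⇒criterion : LowerBound → Criterion a k
  lower⇒criterion lower = ≤-antisym (proj₂ (bounds k)) (lower k ≤-refl) , λ j r<j → lower j (<⇒≤ r<j)

  criterion⇒lower : Criterion a k → LowerBound
  criterion⇒lower (a-k≡ , later) i r≤i with m≤n⇒m<n∨m≡n r≤i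
  ... | inj₁ r<i = later i r<i
  ... | inj₂ r≡i = subst (λ i → lookup a i ≥ 2 * r + 1) (toℕ-injective r≡i) (≤-reflexive (sym a-k≡))

lemma3p4 : (n : ℕ) → 1 ≤ n → (a : Vec ℕ n) →
    ((i : Fin n) → 1 ≤ lookup a i × lookup a i ≤ 2 * toℕ i + 1) →
    SignDisconnected n (stdPerm (toList a)) ⇔
      Σ (Fin n) (λ k → 1 ≤ toℕ k × lookup a k ≡ 2 * toℕ k + 1 ×
        ((j : Fin n) → toℕ k < toℕ j → lookup a j ≥ 2 * toℕ k + 1))
lemma3p4 n _ a bounds rewrite stdPerm≡perm a =
  ⇔-trans (Insertion.disconnected⇔split (offsets a) n)
          (mk⇔ (λ (k , 1≤k , keeps) → k , 1≤k , Equivalence.to (keeps⇔criterion a bounds k) keeps)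
               (λ (k , 1≤k , holds) → k , 1≤k , Equivalence.from (keeps⇔criterion a bounds k) holds))
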